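{- Let $n\geq 4$. Among all connected graphs on $n$ vertices with exactly $n-2$ pendant vertices, the tree $T(1,n-3,2)$ has the maximum core index. Furthermore, $F(T(1,n-3,2))=3\cdot 2^{n-3}+n$.
   Context: All graphs are finite, simple and undirected. A pendant vertex is a vertex of degree one. For positive integers $k,l,d$, $T(k,l,d)$ is the tree on $k+l+d$ vertices obtained from the path $v_1v_2\cdots v_d$ by attaching $k$ new pendant vertices to $v_1$ and $l$ new pendant vertices to $v_d$. A connected subgraph of a graph $G=(V,E)$ is a graph $(V',E')$ with $\emptyset\neq V'\subseteq V$, $E'\subseteq E$, every edge of $E'$ having both endpoints in $V'$, and $(V',E')$ connected; distinct pairs $(V',E')$ are counted separately. The core index $F(G)$ is the number of connected subgraphs of $G$. -}

module Defs where

open import Data.Bool using (Bool; true; false; _∧_; _∨_)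
open import Data.Nat using (ℕ; zero; suc; _+_; _∸_; _≡ᵇ_; _<ᵇ_; _≤ᵇ_)
open import Data.Fin using (Fin; toℕ)
open import Data.Vec using (Vec; []; _∷_; lookup; tabulate)
open import Data.List using (List; length)
open import Data.List.Membership.Propositional using (_∈_)
open import Data.List.Relation.Unary.Unique.Propositional using (Unique)
open import Data.Product using (Σ; ∃; _×_)
open import Function.Bundles using (_⇔_)
open import Relation.Binary.PropositionalEquality using (_≡_)

Graph : ℕ → Set
Graph n = Vec (Vec Bool n) n

adj : ∀ {n} → Graph n → Fin n → Fin n → Bool
adj A i j = lookup (lookup A i) j

IsSimple : ∀ {n} → Graph n → Set
IsSimple A = (∀ i j → adj A i j ≡ adj A j i) × (∀ i → adj A i i ≡ false)

data Walk {n} (A : Graph n) : Fin n → Fin n → Set where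
  here : ∀ {u} → Walk A u u
  step : ∀ {u w v} → adj A u w ≡ true → Walk A w v → Walk A u v

Connected : ∀ {n} → Graph n → Set
Connected A = ∀ u v → Walk A u v

trues : ∀ {m} → Vec Bool m → ℕ
trues [] = 0
trues (true ∷ bs) = suc (trues bs)
trues (false ∷ bs) = trues bs

degree : ∀ {n} → Graph n → Fin n → ℕ
degree A i = trues (lookup A i)

pendantCount : ∀ {n} → Graph n → ℕ
pendantCount A = trues (tabulate λ i → degree A i ≡ᵇ 1)

-- A candidate subgraph (V', E'): V' a vertex subset, E' a (symmetric) edge set
-- given as an adjacency matrix.
SubData : ℕ → Set
SubData n = Vec Bool n × Graph n

IsConnectedSubgraph : ∀ {n} → Graph n → SubData n → Set
IsConnectedSubgraph A (V Data.Product., B) =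
  (∃ λ i → lookup V i ≡ true)
  × (∀ i j → adj B i j ≡ adj B j i)
  × (∀ i j → adj B i j ≡ true → adj A i j ≡ true)
  × (∀ i j → adj B i j ≡ true → lookup V i ≡ true × lookup V j ≡ true)
  × (∀ u v → lookup V u ≡ true → lookup V v ≡ true → Walk B u v)

HasSize : {X : Set} → (X → Set) → ℕ → Set
HasSize {X} P k =
  Σ (List X) λ xs → (length xs ≡ k) × Unique xs × (∀ x → (x ∈ xs) ⇔ P x)

CoreIndex : ∀ {n} → Graph n → ℕ → Set
CoreIndex A k = HasSize (IsConnectedSubgraph A) k

-- T(k,l,d) on vertices 0 .. k+l+d-1 : vertices 0..d-1 form the path v_1 … v_d,
-- vertices d..d+k-1 are pendants at v_1 (= 0), vertices d+k..d+k+l-1 are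
-- pendants at v_d (= d-1).
Tadj : ℕ → ℕ → ℕ → ℕ → ℕ → Bool
Tadj k l d i j = pathE i j ∨ pathE j i ∨ pend i j ∨ pend j i
  where
  pathE : ℕ → ℕ → Bool
  pathE a b = (suc a ≡ᵇ b) ∧ (b <ᵇ d)
  pend : ℕ → ℕ → Bool
  pend a b = ((b ≡ᵇ 0) ∧ (d ≤ᵇ a) ∧ (a <ᵇ d + k))
           ∨ ((b ≡ᵇ (d ∸ 1)) ∧ (d + k ≤ᵇ a) ∧ (a <ᵇ d + k + l))

T : (k l d : ℕ) → Graph (k + l + d)
T k l d = tabulate λ i → tabulate λ j → Tadj k l d (toℕ i) (toℕ j)

-- A connected graph on n vertices in which all vertices but two, u and v, are pendant is a
-- double star: u and v are adjacent and every other vertex is a leaf hanging from u or from v,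
-- say a leaves at u and b at v, with a, b ≥ 1 and a + b = n − 2; T(1, n − 3, 2) is the case a = 1.
-- A double star is a tree, so a connected subgraph is the subgraph induced by its vertex set,
-- and the connected vertex sets are the n singletons, the 2^(a+b) sets containing both u and v,
-- and the 2^a − 1 (resp. 2^b − 1) sets made of u (resp. v) and some of its own leaves.  Hence
-- F = n + 2^(a+b) + 2^a + 2^b − 2, and (2^(a−1) − 1)(2^(b−1) − 1) ≥ 0 bounds this by
-- 3·2^(n−3) + n, with equality when a = 1.

module Submission where

open import Defs
open import Data.Bool using (Bool; true; false; _∧_; _∨_; not)
open import Data.Bool.Properties
  using (∧-zeroʳ; ∧-comm; ∨-comm; ∧-distribʳ-∨; ¬-not; not-injective; ⇔→≡; T-≡)
  renaming (_≟_ to _≟ᵇ_)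
open import Data.Nat using (ℕ; zero; suc; _+_; _*_; _∸_; _^_; _≤_; _<_; z≤n; s≤s; _≡ᵇ_; _<ᵇ_)
open import Data.Nat.Properties
  using (≡ᵇ⇒≡; <⇒<ᵇ; suc-injective; +-identityʳ; +-comm; +-suc; +-cancelˡ-≡; +-cancelʳ-≡; +-cancelʳ-≤;
         +-monoʳ-≤; ≤-reflexive; *-monoʳ-≤; *-distribʳ-+; ^-distribˡ-+-*; m≤m+n; m^n>0; m+[n∸m]≡n;
         +-commutativeSemigroup; module ≤-Reasoning)
open import Data.Nat.Tactic.RingSolver using (solve-∀)
open import Algebra.Properties.CommutativeSemigroup +-commutativeSemigroup
  using () renaming (interchange to +-interchange)
open import Data.Fin using (Fin; zero; suc; toℕ; fromℕ<)
open import Data.Fin.Properties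
  using (_≟_; toℕ-injective; toℕ<n; toℕ-fromℕ<) renaming (suc-injective to suc-injectiveᶠ)
open import Data.Fin.Subset using (Subset; ⁅_⁆)
open import Data.Vec using (Vec; []; _∷_; lookup; tabulate)
open import Data.Vec.Properties
  using (∷-injectiveˡ; ∷-injectiveʳ; lookup-replicate; lookup∘tabulate; tabulate∘lookup; tabulate-cong)
open import Data.List using (List; []; _∷_; [_]; length; map; _++_)
open import Data.List.Properties using (length-map; length-++)
open import Data.List.Membership.Propositional using (_∈_)
open import Data.List.Membership.Propositional.Properties
  using (∈-map⁺; ∈-map⁻; ∈-++⁺ˡ; ∈-++⁺ʳ; ∈-++⁻)
open import Data.List.Membership.Propositional.Properties.WithK using (unique∧set⇒bag)
open import Data.List.Relation.Binary.BagAndSetEquality using (∼bag⇒↭)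
open import Data.List.Relation.Binary.Permutation.Propositional.Properties using (↭-length)
open import Data.List.Relation.Unary.Any using (here)
open import Data.List.Relation.Unary.All using ([])
open import Data.List.Relation.Unary.AllPairs using ([]; _∷_)
open import Data.List.Relation.Unary.Unique.Propositional using (Unique)
import Data.List.Relation.Unary.Unique.Propositional.Properties as Unique
open import Data.Product using (Σ; ∃; ∃₂; _×_; _,_; proj₁; proj₂)
open import Data.Sum using (_⊎_; inj₁; inj₂)
open import Data.Empty using (⊥; ⊥-elim)
open import Function using (_∘_; _∘′_; case_of_)
open import Function.Bundles using (_⇔_; mk⇔; Equivalence)
import Function.Properties.Equivalence as ⇔
open import Relation.Nullary using (does; yes; no; contradiction)
open import Relation.Nullary.Decidable using (dec-true)
open import Relation.Binary.PropositionalEquality hiding ([_])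

∧-≡-true⁻ : ∀ {a b} → a ∧ b ≡ true → a ≡ true × b ≡ true
∧-≡-true⁻ {true} b≡true = refl , b≡true

∧-≡-true⁺ : ∀ {a b} → a ≡ true → b ≡ true → a ∧ b ≡ true
∧-≡-true⁺ refl refl = refl

∨-≡-true⁻ : ∀ {a b} → a ∨ b ≡ true → a ≡ true ⊎ b ≡ true
∨-≡-true⁻ {true} _ = inj₁ refl
∨-≡-true⁻ {false} b≡true = inj₂ b≡true

∧-≡-false : ∀ {a b} → (a ≡ true → b ≡ true → ⊥) → a ∧ b ≡ false
∧-≡-false {true} {true} ¬both = ⊥-elim (¬both refl refl)
∧-≡-false {true} {false} _ = refl
∧-≡-false {false} _ = refl

∨-∧-self : ∀ a b → (a ∨ b) ∧ a ≡ a
∨-∧-self true b = refl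
∨-∧-self false b = ∧-zeroʳ b

∨-∧-not-self : ∀ a b → (a ∨ b) ∧ not a ≡ b ∧ not a
∨-∧-not-self true b = sym (∧-zeroʳ b)
∨-∧-not-self false b = refl

∨-≡-true⁺ˡ : ∀ {a} b → a ≡ true → a ∨ b ≡ true
∨-≡-true⁺ˡ b refl = refl

∨-≡-true⁺ʳ : ∀ a {b} → b ≡ true → a ∨ b ≡ true
∨-≡-true⁺ʳ true _ = refl
∨-≡-true⁺ʳ false b≡true = b≡true

true≢false : true ≢ false
true≢false ()

bit : Bool → ℕ
bit true = 1
bit false = 0

bit-∨ : ∀ a b → a ∧ b ≡ false → bit (a ∨ b) ≡ bit a + bit b
bit-∨ true false _ = refl
bit-∨ false b _ = refl

bit-split : ∀ a b → bit a ≡ bit (a ∧ b) + bit (a ∧ not b)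
bit-split true true = refl
bit-split true false = refl
bit-split false b = refl

count : ∀ {n} → (Fin n → Bool) → ℕ
count {zero} F = 0
count {suc n} F = bit (F zero) + count (F ∘ suc)

count-cong : ∀ {n} {F G : Fin n → Bool} → (∀ i → F i ≡ G i) → count F ≡ count G
count-cong {zero} F≗G = refl
count-cong {suc n} F≗G = cong₂ _+_ (cong bit (F≗G zero)) (count-cong (F≗G ∘ suc))

count-∨ : ∀ {n} (F G : Fin n → Bool) → (∀ i → F i ∧ G i ≡ false) →
          count (λ i → F i ∨ G i) ≡ count F + count G
count-∨ {zero} F G disjoint = refl
count-∨ {suc n} F G disjoint =
  trans (cong₂ _+_ (bit-∨ (F zero) (G zero) (disjoint zero))
                   (count-∨ (F ∘ suc) (G ∘ suc) (disjoint ∘ suc)))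
        (+-interchange (bit (F zero)) (bit (G zero)) _ _)

count-split : ∀ {n} (F G : Fin n → Bool) →
              count F ≡ count (λ i → F i ∧ G i) + count (λ i → F i ∧ not (G i))
count-split {zero} F G = refl
count-split {suc n} F G =
  trans (cong₂ _+_ (bit-split (F zero) (G zero)) (count-split (F ∘ suc) (G ∘ suc)))
        (+-interchange (bit (F zero ∧ G zero)) _ _ _)

count-true : ∀ n → count {n} (λ _ → true) ≡ n
count-true zero = refl
count-true (suc n) = cong suc (count-true n)

count-none : ∀ {n} (F : Fin n → Bool) → (∀ i → F i ≡ false) → count F ≡ 0
count-none {zero} F none = refl
count-none {suc n} F none rewrite none zero = count-none (F ∘ suc) (none ∘ suc)

count-≟ : ∀ {n} (w : Fin n) → count (λ i → does (i ≟ w)) ≡ 1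
count-≟ {suc n} zero = cong suc (count-none {n} (λ i → does (suc i ≟ zero)) (λ _ → refl))
count-≟ {suc n} (suc w) = count-≟ w

indicator : ∀ {n} (F : Fin n → Bool) {w} → F w ≡ true → (∀ i → F i ≡ true → i ≡ w) →
            ∀ i → F i ≡ does (i ≟ w)
indicator F {w} Fw only i with i ≟ w
... | yes refl = Fw
... | no i≢w = ¬-not (i≢w ∘ only i)

count-point : ∀ {n} (F : Fin n → Bool) (w : Fin n) →
              F w ≡ true → (∀ i → F i ≡ true → i ≡ w) → count F ≡ 1
count-point F w Fw only = trans (count-cong (indicator F Fw only)) (count-≟ w)

count≡0⇒ : ∀ {n} (F : Fin n → Bool) → count F ≡ 0 → ∀ i → F i ≡ false
count≡0⇒ {suc n} F ≡0 i with F zero in F0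
count≡0⇒ {suc n} F ≡0 zero | false = F0
count≡0⇒ {suc n} F ≡0 (suc i) | false = count≡0⇒ (F ∘ suc) ≡0 i

count≡1⇒ : ∀ {n} (F : Fin n → Bool) → count F ≡ 1 →
           ∃ λ w → F w ≡ true × (∀ i → F i ≡ true → i ≡ w)
count≡1⇒ {suc n} F ≡1 with F zero in F0
... | true = zero , F0 , only-zero
  where
  only-zero : ∀ i → F i ≡ true → i ≡ zero
  only-zero zero _ = refl
  only-zero (suc i) Fi = contradiction (trans (sym Fi) (count≡0⇒ (F ∘ suc) (suc-injective ≡1) i)) true≢false
... | false with count≡1⇒ (F ∘ suc) ≡1
...   | w , Fw , only = suc w , Fw , only-suc
  where
  only-suc : ∀ i → F i ≡ true → i ≡ suc w
  only-suc zero Fi = contradiction (trans (sym Fi) F0) true≢false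
  only-suc (suc i) Fi = cong suc (only i Fi)

count≡2⇒ : ∀ {n} (F : Fin n → Bool) → count F ≡ 2 →
           ∃₂ λ u v → u ≢ v × F u ≡ true × F v ≡ true × (∀ i → F i ≡ true → i ≡ u ⊎ i ≡ v)
count≡2⇒ {suc n} F ≡2 with F zero in F0
... | true with count≡1⇒ (F ∘ suc) (suc-injective ≡2)
...   | w , Fw , only = zero , suc w , (λ ()) , F0 , Fw , zero-or-w
  where
  zero-or-w : ∀ i → F i ≡ true → i ≡ zero ⊎ i ≡ suc w
  zero-or-w zero _ = inj₁ refl
  zero-or-w (suc i) Fi = inj₂ (cong suc (only i Fi))
count≡2⇒ {suc n} F ≡2 | false with count≡2⇒ (F ∘ suc) ≡2
... | u , v , u≢v , Fu , Fv , only = suc u , suc v , u≢v ∘ suc-injectiveᶠ , Fu , Fv , only-suc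
  where
  only-suc : ∀ i → F i ≡ true → i ≡ suc u ⊎ i ≡ suc v
  only-suc zero Fi = contradiction (trans (sym Fi) F0) true≢false
  only-suc (suc i) Fi with only i Fi
  ... | inj₁ i≡u = inj₁ (cong suc i≡u)
  ... | inj₂ i≡v = inj₂ (cong suc i≡v)

trues-tabulate : ∀ {n} (F : Fin n → Bool) → trues (tabulate F) ≡ count F
trues-tabulate {zero} F = refl
trues-tabulate {suc n} F with F zero
... | true = cong suc (trues-tabulate (F ∘ suc))
... | false = trues-tabulate (F ∘ suc)

trues-lookup : ∀ {n} (V : Vec Bool n) → trues V ≡ count (lookup V)
trues-lookup [] = refl
trues-lookup (true ∷ V) = cong suc (trues-lookup V)
trues-lookup (false ∷ V) = trues-lookup V

countSubsets : ∀ {n} → (Subset n → Bool) → ℕ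
countSubsets {zero} f = bit (f [])
countSubsets {suc n} f = countSubsets (f ∘ (true ∷_)) + countSubsets (f ∘ (false ∷_))

countSubsets-cong : ∀ {n} {f g : Subset n → Bool} → (∀ V → f V ≡ g V) →
                    countSubsets f ≡ countSubsets g
countSubsets-cong {zero} f≗g = cong bit (f≗g [])
countSubsets-cong {suc n} f≗g =
  cong₂ _+_ (countSubsets-cong (f≗g ∘ (true ∷_))) (countSubsets-cong (f≗g ∘ (false ∷_)))

countSubsets-∨ : ∀ {n} (f g : Subset n → Bool) → (∀ V → f V ∧ g V ≡ false) →
                 countSubsets (λ V → f V ∨ g V) ≡ countSubsets f + countSubsets g
countSubsets-∨ {zero} f g disjoint = bit-∨ (f []) (g []) (disjoint [])
countSubsets-∨ {suc n} f g disjoint =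
  trans (cong₂ _+_ (countSubsets-∨ (f ∘ (true ∷_)) (g ∘ (true ∷_)) (disjoint ∘ (true ∷_)))
                   (countSubsets-∨ (f ∘ (false ∷_)) (g ∘ (false ∷_)) (disjoint ∘ (false ∷_))))
        (+-interchange (countSubsets (f ∘ (true ∷_))) _ _ _)

countSubsets-split : ∀ {n} (f g : Subset n → Bool) →
  countSubsets f ≡ countSubsets (λ V → f V ∧ g V) + countSubsets (λ V → f V ∧ not (g V))
countSubsets-split {zero} f g = bit-split (f []) (g [])
countSubsets-split {suc n} f g =
  trans (cong₂ _+_ (countSubsets-split (f ∘ (true ∷_)) (g ∘ (true ∷_)))
                   (countSubsets-split (f ∘ (false ∷_)) (g ∘ (false ∷_))))
        (+-interchange (countSubsets (λ V → f (true ∷ V) ∧ g (true ∷ V))) _ _ _)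

countSubsets-none : ∀ {n} (f : Subset n → Bool) → (∀ V → f V ≡ false) → countSubsets f ≡ 0
countSubsets-none {zero} f none = cong bit (none [])
countSubsets-none {suc n} f none =
  cong₂ _+_ (countSubsets-none (f ∘ (true ∷_)) (none ∘ (true ∷_)))
            (countSubsets-none (f ∘ (false ∷_)) (none ∘ (false ∷_)))

countSubsets-point : ∀ {n} (f : Subset n → Bool) (W : Subset n) →
                     f W ≡ true → (∀ V → f V ≡ true → V ≡ W) → countSubsets f ≡ 1
countSubsets-point f [] fW _ = cong bit fW
countSubsets-point f (true ∷ W) fW only =
  cong₂ _+_ (countSubsets-point (f ∘ (true ∷_)) W fW (λ V → ∷-injectiveʳ ∘ only (true ∷ V)))
            (countSubsets-none (f ∘ (false ∷_))
              (λ V → ¬-not (λ fV → true≢false (sym (∷-injectiveˡ (only (false ∷ V) fV))))))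
countSubsets-point f (false ∷ W) fW only =
  cong₂ _+_ (countSubsets-none (f ∘ (true ∷_))
              (λ V → ¬-not (λ fV → true≢false (∷-injectiveˡ (only (true ∷ V) fV)))))
            (countSubsets-point (f ∘ (false ∷_)) W fW (λ V → ∷-injectiveʳ ∘ only (false ∷ V)))

countSubsets-∧ : ∀ {n} b (f : Subset n → Bool) → countSubsets (λ V → b ∧ f V) ≡ bit b * countSubsets f
countSubsets-∧ true f = sym (+-identityʳ (countSubsets f))
countSubsets-∧ {n} false f = countSubsets-none {n} (λ _ → false) (λ _ → refl)

isSingleton : ∀ {n} → Subset n → Bool
isSingleton V = trues V ≡ᵇ 1

countSubsets-singletons : ∀ n → countSubsets {n} isSingleton ≡ n
countSubsets-singletons zero = refl
countSubsets-singletons (suc n) = cong₂ _+_ (countSubsets-empty n) (countSubsets-singletons n)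
  where
  countSubsets-empty : ∀ n → countSubsets {n} (λ V → trues V ≡ᵇ 0) ≡ 1
  countSubsets-empty zero = refl
  countSubsets-empty (suc n) =
    cong₂ _+_ (countSubsets-none {n} (λ V → suc (trues V) ≡ᵇ 0) (λ _ → refl)) (countSubsets-empty n)

allᵇ : ∀ {n} → (Fin n → Bool → Bool) → Subset n → Bool
allᵇ ok [] = true
allᵇ ok (b ∷ V) = ok zero b ∧ allᵇ (ok ∘ suc) V

allᵇ⁻ : ∀ {n} (ok : Fin n → Bool → Bool) V → allᵇ ok V ≡ true → ∀ i → ok i (lookup V i) ≡ true
allᵇ⁻ ok (b ∷ V) all zero = proj₁ (∧-≡-true⁻ all)
allᵇ⁻ ok (b ∷ V) all (suc i) = allᵇ⁻ (ok ∘ suc) V (proj₂ (∧-≡-true⁻ {ok zero b} all)) i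

allᵇ⁺ : ∀ {n} (ok : Fin n → Bool → Bool) V → (∀ i → ok i (lookup V i) ≡ true) → allᵇ ok V ≡ true
allᵇ⁺ ok [] _ = refl
allᵇ⁺ ok (b ∷ V) each = ∧-≡-true⁺ (each zero) (allᵇ⁺ (ok ∘ suc) V (each ∘ suc))

choices : (Bool → Bool) → ℕ
choices p = bit (p true) + bit (p false)

countSubsets-allᵇ : ∀ {n} (ok : Fin n → Bool → Bool) (free : Fin n → Bool) →
                    (∀ i → choices (ok i) ≡ 2 ^ bit (free i)) →
                    countSubsets (allᵇ ok) ≡ 2 ^ count free
countSubsets-allᵇ {zero} ok free _ = refl
countSubsets-allᵇ {suc n} ok free choices≡ = begin
  countSubsets (λ V → ok zero true ∧ allᵇ (ok ∘ suc) V) +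
  countSubsets (λ V → ok zero false ∧ allᵇ (ok ∘ suc) V)
    ≡⟨ cong₂ _+_ (countSubsets-∧ (ok zero true) (allᵇ (ok ∘ suc)))
                 (countSubsets-∧ (ok zero false) (allᵇ (ok ∘ suc))) ⟩
  bit (ok zero true) * rest + bit (ok zero false) * rest
    ≡⟨ sym (*-distribʳ-+ rest (bit (ok zero true)) _) ⟩
  choices (ok zero) * rest
    ≡⟨ cong₂ _*_ (choices≡ zero) (countSubsets-allᵇ (ok ∘ suc) (free ∘ suc) (choices≡ ∘ suc)) ⟩
  2 ^ bit (free zero) * 2 ^ count (free ∘ suc)
    ≡⟨ sym (^-distribˡ-+-* 2 (bit (free zero)) _) ⟩
  2 ^ count free ∎
  where
  open ≡-Reasoning
  rest = countSubsets (allᵇ (ok ∘ suc))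

lookup-ext : ∀ {A : Set} {n} {xs ys : Vec A n} → (∀ i → lookup xs i ≡ lookup ys i) → xs ≡ ys
lookup-ext {xs = xs} {ys} xs≗ys = begin
  xs                   ≡⟨ sym (tabulate∘lookup xs) ⟩
  tabulate (lookup xs) ≡⟨ tabulate-cong xs≗ys ⟩
  tabulate (lookup ys) ≡⟨ tabulate∘lookup ys ⟩
  ys                   ∎
  where open ≡-Reasoning

lookup-⁅⁆ : ∀ {n} (w i : Fin n) → lookup ⁅ w ⁆ i ≡ does (i ≟ w)
lookup-⁅⁆ zero zero = refl
lookup-⁅⁆ zero (suc i) = lookup-replicate i false
lookup-⁅⁆ (suc w) zero = refl
lookup-⁅⁆ (suc w) (suc i) = lookup-⁅⁆ w i

isSingleton⇒ : ∀ {n} (V : Subset n) → isSingleton V ≡ true →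
               ∃ λ w → lookup V w ≡ true × (∀ i → lookup V i ≡ true → i ≡ w)
isSingleton⇒ V single =
  count≡1⇒ (lookup V) (trans (sym (trues-lookup V)) (≡ᵇ⇒≡ (trues V) 1 (Equivalence.from T-≡ single)))

isSingleton⇐ : ∀ {n} (V : Subset n) (w : Fin n) → lookup V w ≡ true →
               (∀ i → lookup V i ≡ true → i ≡ w) → isSingleton V ≡ true
isSingleton⇐ V w Vw only rewrite trues-lookup V | count-point (lookup V) w Vw only = refl

isSingleton-⁅⁆ : ∀ {n} (w : Fin n) → isSingleton ⁅ w ⁆ ≡ true
isSingleton-⁅⁆ w rewrite trues-lookup ⁅ w ⁆ | count-cong (lookup-⁅⁆ w) | count-≟ w = refl

≡⁅⁆ : ∀ {n} (V : Subset n) (w : Fin n) → lookup V w ≡ true → (∀ i → lookup V i ≡ true → i ≡ w) →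
      V ≡ ⁅ w ⁆
≡⁅⁆ V w Vw only = lookup-ext λ i → trans (indicator (lookup V) Vw only i) (sym (lookup-⁅⁆ w i))

isSingleton-two : ∀ {n} (V : Subset n) {i j} → lookup V i ≡ true → lookup V j ≡ true → i ≢ j →
                  isSingleton V ≡ false
isSingleton-two V Vi Vj i≢j = ¬-not λ single →
  let w , _ , only = isSingleton⇒ V single in i≢j (trans (only _ Vi) (sym (only _ Vj)))

HasSize-unique : ∀ {X : Set} {P : X → Set} {k l} → HasSize P k → HasSize P l → k ≡ l
HasSize-unique (xs , refl , xs! , ∈xs) (ys , refl , ys! , ∈ys) =
  ↭-length (∼bag⇒↭ (unique∧set⇒bag xs! ys! (λ {x} → ⇔.trans (∈xs x) (⇔.sym (∈ys x)))))

HasSize-image : ∀ {X Y : Set} {P : X → Set} {Q : Y → Set} {k} (f : X → Y) →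
                (∀ {x x′} → f x ≡ f x′ → x ≡ x′) →
                (∀ y → Q y ⇔ (∃ λ x → P x × f x ≡ y)) →
                HasSize P k → HasSize Q k
HasSize-image {P = P} {Q} f f-injective Q⇔image (xs , refl , xs! , ∈xs) =
  map f xs , length-map f xs , Unique.map⁺ f-injective xs! , λ y → mk⇔ (to y) (from y)
  where
  to : ∀ y → y ∈ map f xs → Q y
  to y y∈ with ∈-map⁻ f y∈
  ... | x , x∈ , refl = Equivalence.from (Q⇔image y) (x , Equivalence.to (∈xs x) x∈ , refl)
  from : ∀ y → Q y → y ∈ map f xs
  from y Qy with Equivalence.to (Q⇔image y) Qy
  ... | x , Px , refl = ∈-map⁺ f (Equivalence.from (∈xs x) Px)

subsets : ∀ {n} → (Subset n → Bool) → List (Subset n)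
subsets {zero} f with f []
... | true = [ [] ]
... | false = []
subsets {suc n} f = map (true ∷_) (subsets (f ∘ (true ∷_))) ++ map (false ∷_) (subsets (f ∘ (false ∷_)))

length-subsets : ∀ {n} (f : Subset n → Bool) → length (subsets f) ≡ countSubsets f
length-subsets {zero} f with f []
... | true = refl
... | false = refl
length-subsets {suc n} f = begin
  length (map (true ∷_) (subsets (f ∘ (true ∷_))) ++ map (false ∷_) (subsets (f ∘ (false ∷_))))
    ≡⟨ length-++ (map (true ∷_) (subsets (f ∘ (true ∷_)))) ⟩
  length (map (true ∷_) (subsets (f ∘ (true ∷_)))) + length (map (false ∷_) (subsets (f ∘ (false ∷_))))
    ≡⟨ cong₂ _+_ (length-map (true ∷_) (subsets (f ∘ (true ∷_))))
                 (length-map (false ∷_) (subsets (f ∘ (false ∷_)))) ⟩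
  length (subsets (f ∘ (true ∷_))) + length (subsets (f ∘ (false ∷_)))
    ≡⟨ cong₂ _+_ (length-subsets (f ∘ (true ∷_))) (length-subsets (f ∘ (false ∷_))) ⟩
  countSubsets f ∎
  where open ≡-Reasoning

subsets-unique : ∀ {n} (f : Subset n → Bool) → Unique (subsets f)
subsets-unique {zero} f with f []
... | true = [] ∷ []
... | false = []
subsets-unique {suc n} f =
  Unique.++⁺ (Unique.map⁺ ∷-injectiveʳ (subsets-unique (f ∘ (true ∷_))))
             (Unique.map⁺ ∷-injectiveʳ (subsets-unique (f ∘ (false ∷_))))
             heads-differ
  where
  heads-differ : ∀ {V} → V ∈ map (true ∷_) (subsets (f ∘ (true ∷_))) ×
                         V ∈ map (false ∷_) (subsets (f ∘ (false ∷_))) → ⊥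
  heads-differ (∈true , ∈false) with ∈-map⁻ (true ∷_) ∈true | ∈-map⁻ (false ∷_) ∈false
  ... | _ , _ , refl | _ , _ , ()

∈-subsets : ∀ {n} (f : Subset n → Bool) V → V ∈ subsets f ⇔ f V ≡ true
∈-subsets f V = mk⇔ (to f V) (from f V)
  where
  to : ∀ {n} (f : Subset n → Bool) V → V ∈ subsets f → f V ≡ true
  to {zero} f [] V∈ with f []
  ... | true = refl
  to {suc n} f V V∈ with ∈-++⁻ (map (true ∷_) (subsets (f ∘ (true ∷_)))) V∈
  ... | inj₁ ∈true with ∈-map⁻ (true ∷_) ∈true
  ...   | W , W∈ , refl = to (f ∘ (true ∷_)) W W∈
  to {suc n} f V V∈ | inj₂ ∈false with ∈-map⁻ (false ∷_) ∈false
  ...   | W , W∈ , refl = to (f ∘ (false ∷_)) W W∈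
  from : ∀ {n} (f : Subset n → Bool) V → f V ≡ true → V ∈ subsets f
  from {zero} f [] fV with f []
  ... | true = here refl
  from {suc n} f (true ∷ V) fV = ∈-++⁺ˡ (∈-map⁺ (true ∷_) (from (f ∘ (true ∷_)) V fV))
  from {suc n} f (false ∷ V) fV =
    ∈-++⁺ʳ (map (true ∷_) (subsets (f ∘ (true ∷_)))) (∈-map⁺ (false ∷_) (from (f ∘ (false ∷_)) V fV))

HasSize-countSubsets : ∀ {n} (f : Subset n → Bool) → HasSize (λ V → f V ≡ true) (countSubsets f)
HasSize-countSubsets f = subsets f , length-subsets f , subsets-unique f , ∈-subsets f

-- Walks and induced subgraphs

module _ {n} {G : Graph n} where

  _++ʷ_ : ∀ {a b c} → Walk G a b → Walk G b c → Walk G a c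
  here ++ʷ q = q
  step e p ++ʷ q = step e (p ++ʷ q)

  reverseʷ : (∀ i j → adj G i j ≡ adj G j i) → ∀ {a b} → Walk G a b → Walk G b a
  reverseʷ sym-G here = here
  reverseʷ sym-G (step {u} {w} e p) = reverseʷ sym-G p ++ʷ step (trans (sym-G w u) e) here

  first-edge : ∀ {a b} → Walk G a b → a ≢ b → ∃ λ c → adj G a c ≡ true
  first-edge here a≢a = ⊥-elim (a≢a refl)
  first-edge (step e _) _ = _ , e

  walk-exit : (S : Fin n → Bool) → ∀ {a b} → Walk G a b → S a ≡ true → S b ≡ false →
              ∃₂ λ x y → adj G x y ≡ true × S x ≡ true × S y ≡ false
  walk-exit S here Sa Sb = ⊥-elim (true≢false (trans (sym Sa) Sb))
  walk-exit S (step {w = w} e p) Sa Sb with S w in Sw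
  ... | true = walk-exit S p Sw Sb
  ... | false = _ , w , e , Sa , Sw

  connected-via : (∀ i j → adj G i j ≡ adj G j i) → (h : Fin n) → (∀ a → Walk G a h) → Connected G
  connected-via sym-G h to-h a b = to-h a ++ʷ reverseʷ sym-G (to-h b)

edge-irrefl : ∀ {n} (G : Graph n) → IsSimple G → ∀ {i j} → adj G i j ≡ true → i ≢ j
edge-irrefl G (_ , irrefl) {i} e refl = true≢false (trans (sym e) (irrefl i))

graph-ext : ∀ {n} {B C : Graph n} → (∀ i j → adj B i j ≡ adj C i j) → B ≡ C
graph-ext B≗C = lookup-ext λ i → lookup-ext (B≗C i)

adj-tabulate : ∀ {n} (f : Fin n → Fin n → Bool) i j → adj (tabulate λ i → tabulate λ j → f i j) i j ≡ f i j
adj-tabulate f i j = trans (cong (λ row → lookup row j) (lookup∘tabulate (λ i → tabulate (f i)) i))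
                           (lookup∘tabulate (f i) j)

degree≡1⇒ : ∀ {n} (G : Graph n) x → degree G x ≡ 1 →
            ∃ λ w → adj G x w ≡ true × (∀ y → adj G x y ≡ true → y ≡ w)
degree≡1⇒ G x deg = count≡1⇒ (adj G x) (trans (sym (trues-lookup (lookup G x))) deg)

degree≡1-unique : ∀ {n} (G : Graph n) {x y z} → degree G x ≡ 1 →
                  adj G x y ≡ true → adj G x z ≡ true → y ≡ z
degree≡1-unique G {x} {y} {z} deg ey ez with degree≡1⇒ G x deg
... | w , _ , only = trans (only y ey) (sym (only z ez))

pendant-pair-closed : ∀ {n} (G : Graph n) {i j} → degree G i ≡ 1 → degree G j ≡ 1 →
                      adj G i j ≡ true → adj G j i ≡ true →
                      ∀ {a t} → a ≡ i ⊎ a ≡ j → Walk G a t → t ≡ i ⊎ t ≡ j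
pendant-pair-closed G deg-i deg-j eij eji a∈ here = a∈
pendant-pair-closed G deg-i deg-j eij eji (inj₁ refl) (step e w) =
  pendant-pair-closed G deg-i deg-j eij eji (inj₂ (degree≡1-unique G deg-i e eij)) w
pendant-pair-closed G deg-i deg-j eij eji (inj₂ refl) (step e w) =
  pendant-pair-closed G deg-i deg-j eij eji (inj₁ (degree≡1-unique G deg-j e eji)) w

induced : ∀ {n} → Graph n → Subset n → Graph n
induced G V = tabulate λ i → tabulate λ j → adj G i j ∧ (lookup V i ∧ lookup V j)

module _ {n} (G : Graph n) (V : Subset n) where

  adj-induced : ∀ i j → adj (induced G V) i j ≡ adj G i j ∧ (lookup V i ∧ lookup V j)
  adj-induced = adj-tabulate (λ i j → adj G i j ∧ (lookup V i ∧ lookup V j))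

  induced-edge : ∀ {i j} → adj G i j ≡ true → lookup V i ≡ true → lookup V j ≡ true →
                 adj (induced G V) i j ≡ true
  induced-edge {i} {j} e Vi Vj = trans (adj-induced i j) (∧-≡-true⁺ e (∧-≡-true⁺ Vi Vj))

  induced-edge⁻ : ∀ {i j} → adj (induced G V) i j ≡ true →
                  adj G i j ≡ true × lookup V i ≡ true × lookup V j ≡ true
  induced-edge⁻ {i} {j} e with ∧-≡-true⁻ (trans (sym (adj-induced i j)) e)
  ... | e′ , inside = e′ , ∧-≡-true⁻ inside

  induced-connected : (∀ i j → adj G i j ≡ adj G j i) → (∃ λ i → lookup V i ≡ true) →
                      (h : Fin n) → (∀ a → lookup V a ≡ true → Walk (induced G V) a h) →
                      IsConnectedSubgraph G (V , induced G V)
  induced-connected sym-G nonempty h to-h =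
    nonempty , sym-induced , (λ i j → proj₁ ∘′ induced-edge⁻) , (λ i j → proj₂ ∘′ induced-edge⁻) ,
    λ a b Va Vb → to-h a Va ++ʷ reverseʷ sym-induced (to-h b Vb)
    where
    sym-induced : ∀ i j → adj (induced G V) i j ≡ adj (induced G V) j i
    sym-induced i j = trans (adj-induced i j)
      (trans (cong₂ _∧_ (sym-G i j) (∧-comm (lookup V i) (lookup V j))) (sym (adj-induced j i)))

  ≡induced : (B : Graph n) → (∀ i j → adj B i j ≡ true → adj G i j ≡ true) →
             (∀ i j → adj B i j ≡ true → lookup V i ≡ true × lookup V j ≡ true) →
             (∀ i j → adj G i j ≡ true → lookup V i ≡ true → lookup V j ≡ true → adj B i j ≡ true) →
             B ≡ induced G V
  ≡induced B B⊆G B⊆V G[V]⊆B = graph-ext λ i j → ⇔→≡ (mk⇔ (to i j) (from i j))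
    where
    to : ∀ i j → adj B i j ≡ true → adj (induced G V) i j ≡ true
    to i j e = induced-edge (B⊆G i j e) (proj₁ (B⊆V i j e)) (proj₂ (B⊆V i j e))
    from : ∀ i j → adj (induced G V) i j ≡ true → adj B i j ≡ true
    from i j e with induced-edge⁻ e
    ... | e′ , Vi , Vj = G[V]⊆B i j e′ Vi Vj

-- Double stars

data Role : Set where
  hubˡ hubʳ leafˡ leafʳ : Role

_==_ : Role → Role → Bool
hubˡ == hubˡ = true
hubʳ == hubʳ = true
leafˡ == leafˡ = true
leafʳ == leafʳ = true
_ == _ = false

==-refl : ∀ r → r == r ≡ true
==-refl hubˡ = refl
==-refl hubʳ = refl
==-refl leafˡ = refl
==-refl leafʳ = refl

==-sound : ∀ {r s} → r == s ≡ true → r ≡ s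
==-sound {hubˡ} {hubˡ} _ = refl
==-sound {hubʳ} {hubʳ} _ = refl
==-sound {leafˡ} {leafˡ} _ = refl
==-sound {leafʳ} {leafʳ} _ = refl

==-role : ∀ {n} (role : Fin n → Role) {r h} → role h ≡ r → (∀ {i} → role i ≡ r → i ≡ h) →
          ∀ i → r == role i ≡ does (i ≟ h)
==-role role {r} rh only =
  indicator (λ i → r == role i) (trans (cong (r ==_) rh) (==-refl r)) (λ i → only ∘ sym ∘ ==-sound)

-- A double star is the path leafˡ — hubˡ — hubʳ — leafʳ with both end vertices blown up into
-- any number of leaves; arc orients the edges of that path.
arc : Role → Role → Bool
arc leafˡ hubˡ = true
arc hubˡ hubʳ = true
arc leafʳ hubʳ = true
arc _ _ = false

linked : Role → Role → Bool
linked r s = arc r s ∨ arc s r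

linked-sym : ∀ r s → linked r s ≡ linked s r
linked-sym r s = ∨-comm (arc r s) (arc s r)

linked-irrefl : ∀ r → linked r r ≡ false
linked-irrefl hubˡ = refl
linked-irrefl hubʳ = refl
linked-irrefl leafˡ = refl
linked-irrefl leafʳ = refl

isLeaf : Role → Bool
isLeaf r = leafˡ == r ∨ leafʳ == r

sideˡ sideʳ : Role → Bool
sideˡ r = hubˡ == r ∨ leafˡ == r
sideʳ r = hubʳ == r ∨ leafʳ == r

==-disjoint : ∀ r s → r ≢ s → ∀ t → r == t ∧ s == t ≡ false
==-disjoint r s r≢s t = ∧-≡-false λ rt st → r≢s (trans (==-sound rt) (sym (==-sound st)))

sides-disjoint : ∀ r → sideˡ r ∧ sideʳ r ≡ false
sides-disjoint hubˡ = refl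
sides-disjoint hubʳ = refl
sides-disjoint leafˡ = refl
sides-disjoint leafʳ = refl

sides-cover : ∀ r → sideˡ r ∨ sideʳ r ≡ true
sides-cover hubˡ = refl
sides-cover hubʳ = refl
sides-cover leafˡ = refl
sides-cover leafʳ = refl

linked-hubˡ≡ : ∀ s → linked hubˡ s ≡ hubʳ == s ∨ leafˡ == s
linked-hubˡ≡ hubˡ = refl
linked-hubˡ≡ hubʳ = refl
linked-hubˡ≡ leafˡ = refl
linked-hubˡ≡ leafʳ = refl

linked-hubʳ≡ : ∀ s → linked hubʳ s ≡ hubˡ == s ∨ leafʳ == s
linked-hubʳ≡ hubˡ = refl
linked-hubʳ≡ hubʳ = refl
linked-hubʳ≡ leafˡ = refl
linked-hubʳ≡ leafʳ = refl

linked-leafˡ≡ : ∀ s → linked leafˡ s ≡ hubˡ == s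
linked-leafˡ≡ hubˡ = refl
linked-leafˡ≡ hubʳ = refl
linked-leafˡ≡ leafˡ = refl
linked-leafˡ≡ leafʳ = refl

linked-leafʳ≡ : ∀ s → linked leafʳ s ≡ hubʳ == s
linked-leafʳ≡ hubˡ = refl
linked-leafʳ≡ hubʳ = refl
linked-leafʳ≡ leafˡ = refl
linked-leafʳ≡ leafʳ = refl

linked-leafˡ : ∀ {s} → linked leafˡ s ≡ true → s ≡ hubˡ
linked-leafˡ {hubˡ} _ = refl

linked-leafʳ : ∀ {s} → linked leafʳ s ≡ true → s ≡ hubʳ
linked-leafʳ {hubʳ} _ = refl

linked-exitˡ : ∀ r s → linked r s ≡ true → sideˡ r ≡ true → sideˡ s ≡ false → r ≡ hubˡ × s ≡ hubʳ
linked-exitˡ hubˡ hubʳ _ _ _ = refl , refl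
linked-exitˡ hubˡ leafʳ () _ _
linked-exitˡ leafˡ hubʳ () _ _
linked-exitˡ leafˡ leafʳ () _ _

data Link (r s : Role) : Set where
  hubs : r ≡ hubˡ → s ≡ hubʳ → Link r s
  hubs′ : r ≡ hubʳ → s ≡ hubˡ → Link r s
  from-leaf : isLeaf r ≡ true → Link r s
  to-leaf : isLeaf s ≡ true → Link r s

link : ∀ r s → linked r s ≡ true → Link r s
link hubˡ hubʳ _ = hubs refl refl
link hubʳ hubˡ _ = hubs′ refl refl
link leafˡ _ _ = from-leaf refl
link leafʳ _ _ = from-leaf refl
link hubˡ leafˡ _ = to-leaf refl
link hubʳ leafʳ _ = to-leaf refl

-- A connected subgraph on at least two vertices of a double star contains both hubs and any
-- leaves, or one hub and any of its own leaves.  Vertices whose role is free may be present or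
-- not; the others are present exactly when required.
data Shape : Set where
  both onlyˡ onlyʳ : Shape

free : Shape → Role → Bool
free both = isLeaf
free onlyˡ = leafˡ ==_
free onlyʳ = leafʳ ==_

required : Shape → Role → Bool
required both _ = true
required onlyˡ = hubˡ ==_
required onlyʳ = hubʳ ==_

allowed : Shape → Role → Bool → Bool
allowed s r x = free s r ∨ does (x ≟ᵇ required s r)

allowed⁻ : ∀ s r x → allowed s r x ≡ true → free s r ≡ false → x ≡ required s r
allowed⁻ s r x ok fixed rewrite fixed with x ≟ᵇ required s r
... | yes x≡required = x≡required

allowed⁺ : ∀ s r x → (free s r ≡ false → x ≡ required s r) → allowed s r x ≡ true
allowed⁺ s r x fixed with free s r
... | true = refl
... | false = dec-true (x ≟ᵇ required s r) (fixed refl)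

choices-allowed : ∀ s r → choices (allowed s r) ≡ 2 ^ bit (free s r)
choices-allowed s r with free s r | required s r
... | true | _ = refl
... | false | true = refl
... | false | false = refl

hubˡ-fixed : ∀ s → free s hubˡ ≡ false
hubˡ-fixed both = refl
hubˡ-fixed onlyˡ = refl
hubˡ-fixed onlyʳ = refl

hubʳ-fixed : ∀ s → free s hubʳ ≡ false
hubʳ-fixed both = refl
hubʳ-fixed onlyˡ = refl
hubʳ-fixed onlyʳ = refl

shape-by-hubs : ∀ s t → required s hubˡ ≡ required t hubˡ → required s hubʳ ≡ required t hubʳ → s ≡ t
shape-by-hubs both both _ _ = refl
shape-by-hubs onlyˡ onlyˡ _ _ = refl
shape-by-hubs onlyʳ onlyʳ _ _ = refl

record DoubleStar {n} (G : Graph n) : Set where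
  field
    role : Fin n → Role
    adj-role : ∀ i j → adj G i j ≡ linked (role i) (role j)
    u v : Fin n
    role-u : role u ≡ hubˡ
    role-v : role v ≡ hubʳ
    hubˡ-only : ∀ {i} → role i ≡ hubˡ → i ≡ u
    hubʳ-only : ∀ {i} → role i ≡ hubʳ → i ≡ v

module DoubleStarProperties {n} {G : Graph n} (D : DoubleStar G) where

  open DoubleStar D

  #_ : (Role → Bool) → ℕ
  # P = count (P ∘ role)

  #-cong : ∀ P Q → (∀ r → P r ≡ Q r) → # P ≡ # Q
  #-cong P Q P≗Q = count-cong (P≗Q ∘ role)

  #-∨ : ∀ P Q → (∀ r → P r ∧ Q r ≡ false) → # (λ r → P r ∨ Q r) ≡ # P + # Q
  #-∨ P Q disjoint = count-∨ (P ∘ role) (Q ∘ role) (disjoint ∘ role)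

  a b : ℕ
  a = # (leafˡ ==_)
  b = # (leafʳ ==_)

  #hubˡ : # (hubˡ ==_) ≡ 1
  #hubˡ = count-point _ u (cong (hubˡ ==_) role-u) (λ i → hubˡ-only ∘ sym ∘ ==-sound)

  #hubʳ : # (hubʳ ==_) ≡ 1
  #hubʳ = count-point _ v (cong (hubʳ ==_) role-v) (λ i → hubʳ-only ∘ sym ∘ ==-sound)

  u≢v : u ≢ v
  u≢v u≡v with trans (sym role-u) (trans (cong role u≡v) role-v)
  ... | ()

  #sideˡ : # sideˡ ≡ suc a
  #sideˡ = trans (#-∨ (hubˡ ==_) (leafˡ ==_) (==-disjoint hubˡ leafˡ λ ())) (cong (_+ a) #hubˡ)

  #sideʳ : # sideʳ ≡ suc b
  #sideʳ = trans (#-∨ (hubʳ ==_) (leafʳ ==_) (==-disjoint hubʳ leafʳ λ ())) (cong (_+ b) #hubʳ)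

  #isLeaf : # isLeaf ≡ a + b
  #isLeaf = #-∨ (leafˡ ==_) (leafʳ ==_) (==-disjoint leafˡ leafʳ λ ())

  vertex-count : suc a + suc b ≡ n
  vertex-count = begin
    suc a + suc b                ≡⟨ sym (cong₂ _+_ #sideˡ #sideʳ) ⟩
    # sideˡ + # sideʳ            ≡⟨ sym (#-∨ sideˡ sideʳ sides-disjoint) ⟩
    # (λ r → sideˡ r ∨ sideʳ r)  ≡⟨ #-cong _ (λ _ → true) sides-cover ⟩
    # (λ _ → true)               ≡⟨ count-true n ⟩
    n                            ∎
    where open ≡-Reasoning

  degree-role : ∀ i → degree G i ≡ # (linked (role i))
  degree-role i = trans (trues-lookup (lookup G i)) (count-cong (adj-role i))

  degree-leaf : ∀ {i} → isLeaf (role i) ≡ true → degree G i ≡ 1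
  degree-leaf {i} leaf with role i | degree-role i
  ... | leafˡ | deg = trans deg (trans (#-cong (linked leafˡ) (hubˡ ==_) linked-leafˡ≡) #hubˡ)
  ... | leafʳ | deg = trans deg (trans (#-cong (linked leafʳ) (hubʳ ==_) linked-leafʳ≡) #hubʳ)

  degree-u : degree G u ≡ suc a
  degree-u = begin
    degree G u                          ≡⟨ degree-role u ⟩
    # (linked (role u))                 ≡⟨ cong (#_ ∘ linked) role-u ⟩
    # (linked hubˡ)                     ≡⟨ #-cong (linked hubˡ) _ linked-hubˡ≡ ⟩
    # (λ r → hubʳ == r ∨ leafˡ == r)    ≡⟨ #-∨ (hubʳ ==_) (leafˡ ==_) (==-disjoint hubʳ leafˡ λ ()) ⟩
    # (hubʳ ==_) + a                    ≡⟨ cong (_+ a) #hubʳ ⟩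
    suc a                               ∎
    where open ≡-Reasoning

  degree-v : degree G v ≡ suc b
  degree-v = begin
    degree G v                          ≡⟨ degree-role v ⟩
    # (linked (role v))                 ≡⟨ cong (#_ ∘ linked) role-v ⟩
    # (linked hubʳ)                     ≡⟨ #-cong (linked hubʳ) _ linked-hubʳ≡ ⟩
    # (λ r → hubˡ == r ∨ leafʳ == r)    ≡⟨ #-∨ (hubˡ ==_) (leafʳ ==_) (==-disjoint hubˡ leafʳ λ ()) ⟩
    # (hubˡ ==_) + b                    ≡⟨ cong (_+ b) #hubˡ ⟩
    suc b                               ∎
    where open ≡-Reasoning

  pendantCount≡ : 1 ≤ a → 1 ≤ b → pendantCount G ≡ a + b
  pendantCount≡ 1≤a 1≤b =
    trans (trues-tabulate (λ i → degree G i ≡ᵇ 1)) (trans (count-cong pendant≗leaf) #isLeaf)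
    where
    hub-not-pendant : ∀ {m} → 1 ≤ m → (suc m ≡ᵇ 1) ≡ false
    hub-not-pendant (s≤s _) = refl
    pendant≗leaf : ∀ i → (degree G i ≡ᵇ 1) ≡ isLeaf (role i)
    pendant≗leaf i with role i in ri
    ... | hubˡ rewrite hubˡ-only ri | degree-u = hub-not-pendant 1≤a
    ... | hubʳ rewrite hubʳ-only ri | degree-v = hub-not-pendant 1≤b
    pendant≗leaf i | leafˡ rewrite degree-leaf {i} (cong isLeaf ri) = refl
    pendant≗leaf i | leafʳ rewrite degree-leaf {i} (cong isLeaf ri) = refl

  isSimple : IsSimple G
  isSimple = (λ i j → trans (adj-role i j) (trans (linked-sym (role i) (role j)) (sym (adj-role j i))))
           , (λ i → trans (adj-role i i) (linked-irrefl (role i)))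

  edge : ∀ {i j r s} → role i ≡ r → role j ≡ s → linked r s ≡ true → adj G i j ≡ true
  edge {i} {j} ri rj rs = trans (adj-role i j) (trans (cong₂ linked ri rj) rs)

  edge⁻ : ∀ {i j} → adj G i j ≡ true → linked (role i) (role j) ≡ true
  edge⁻ {i} {j} e = trans (sym (adj-role i j)) e

  neighbour-leafˡ : ∀ {i j} → role i ≡ leafˡ → adj G i j ≡ true → j ≡ u
  neighbour-leafˡ {j = j} ri e =
    hubˡ-only (linked-leafˡ (subst (λ r → linked r (role j) ≡ true) ri (edge⁻ e)))

  neighbour-leafʳ : ∀ {i j} → role i ≡ leafʳ → adj G i j ≡ true → j ≡ v
  neighbour-leafʳ {j = j} ri e =
    hubʳ-only (linked-leafʳ (subst (λ r → linked r (role j) ≡ true) ri (edge⁻ e)))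

  hubˡ==role : ∀ i → hubˡ == role i ≡ does (i ≟ u)
  hubˡ==role = ==-role role role-u hubˡ-only

  hubʳ==role : ∀ i → hubʳ == role i ≡ does (i ≟ v)
  hubʳ==role = ==-role role role-v hubʳ-only

  to-u : ∀ i → Walk G i u
  to-u i with role i in ri
  ... | hubˡ rewrite hubˡ-only ri = here
  ... | hubʳ rewrite hubʳ-only ri = step (edge role-v role-u refl) here
  ... | leafˡ = step (edge ri role-u refl) here
  ... | leafʳ = step (edge ri role-v refl) (step (edge role-v role-u refl) here)

  connected : Connected G
  connected = connected-via (proj₁ isSimple) u to-u

  fits : Shape → Subset n → Bool
  fits s = allᵇ (λ i → allowed s (role i))

  fits⁻ : ∀ s V i → fits s V ≡ true → free s (role i) ≡ false → lookup V i ≡ required s (role i)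
  fits⁻ s V i fit = allowed⁻ s (role i) (lookup V i) (allᵇ⁻ _ V fit i)

  fits⁺ : ∀ s V → (∀ i → free s (role i) ≡ false → lookup V i ≡ required s (role i)) → fits s V ≡ true
  fits⁺ s V fixed = allᵇ⁺ _ V λ i → allowed⁺ s (role i) (lookup V i) (fixed i)

  fits-u : ∀ s V → fits s V ≡ true → lookup V u ≡ required s hubˡ
  fits-u s V fit = trans (fits⁻ s V u fit (trans (cong (free s) role-u) (hubˡ-fixed s))) (cong (required s) role-u)

  fits-v : ∀ s V → fits s V ≡ true → lookup V v ≡ required s hubʳ
  fits-v s V fit = trans (fits⁻ s V v fit (trans (cong (free s) role-v) (hubʳ-fixed s))) (cong (required s) role-v)

  fits-unique : ∀ s t V → fits s V ≡ true → fits t V ≡ true → s ≡ t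
  fits-unique s t V fit-s fit-t =
    shape-by-hubs s t (trans (sym (fits-u s V fit-s)) (fits-u t V fit-t))
                      (trans (sym (fits-v s V fit-s)) (fits-v t V fit-t))

  countSubsets-fits : ∀ s → countSubsets (fits s) ≡ 2 ^ # (free s)
  countSubsets-fits s = countSubsets-allᵇ _ (free s ∘ role) (λ i → choices-allowed s (role i))

  fitsSome : Subset n → Bool
  fitsSome V = fits both V ∨ (fits onlyˡ V ∨ fits onlyʳ V)

  connectedSet : Subset n → Bool
  connectedSet V = isSingleton V ∨ fitsSome V

  nonSingleton : Shape → Subset n → Bool
  nonSingleton s V = fits s V ∧ not (isSingleton V)

  #nonSingleton : Shape → ℕ
  #nonSingleton s = countSubsets (nonSingleton s)

  countSubsets-connectedSet-split :
    countSubsets connectedSet ≡ n + (#nonSingleton both + (#nonSingleton onlyˡ + #nonSingleton onlyʳ))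
  countSubsets-connectedSet-split = begin
    countSubsets connectedSet
      ≡⟨ countSubsets-split connectedSet isSingleton ⟩
    countSubsets (λ V → connectedSet V ∧ isSingleton V) + countSubsets (λ V → connectedSet V ∧ not (isSingleton V))
      ≡⟨ cong₂ _+_ (countSubsets-cong {n} singletons) (countSubsets-cong others) ⟩
    countSubsets {n} isSingleton + countSubsets (λ V → nonSingleton both V ∨ oneHub V)
      ≡⟨ cong₂ _+_ (countSubsets-singletons n) (countSubsets-∨ (nonSingleton both) oneHub both-disjoint) ⟩
    n + (#nonSingleton both + countSubsets oneHub)
      ≡⟨ cong (λ t → n + (#nonSingleton both + t)) (countSubsets-∨ _ _ oneHub-disjoint) ⟩
    n + (#nonSingleton both + (#nonSingleton onlyˡ + #nonSingleton onlyʳ)) ∎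
    where
    open ≡-Reasoning
    oneHub : Subset n → Bool
    oneHub V = nonSingleton onlyˡ V ∨ nonSingleton onlyʳ V
    singletons : ∀ V → connectedSet V ∧ isSingleton V ≡ isSingleton V
    singletons V = ∨-∧-self (isSingleton V) (fitsSome V)
    others : ∀ V → connectedSet V ∧ not (isSingleton V) ≡ nonSingleton both V ∨ oneHub V
    others V = begin
      connectedSet V ∧ not (isSingleton V)
        ≡⟨ ∨-∧-not-self (isSingleton V) (fitsSome V) ⟩
      (fits both V ∨ (fits onlyˡ V ∨ fits onlyʳ V)) ∧ not (isSingleton V)
        ≡⟨ ∧-distribʳ-∨ (not (isSingleton V)) (fits both V) (fits onlyˡ V ∨ fits onlyʳ V) ⟩
      nonSingleton both V ∨ ((fits onlyˡ V ∨ fits onlyʳ V) ∧ not (isSingleton V))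
        ≡⟨ cong (nonSingleton both V ∨_) (∧-distribʳ-∨ (not (isSingleton V)) (fits onlyˡ V) (fits onlyʳ V)) ⟩
      nonSingleton both V ∨ oneHub V ∎
    distinct : ∀ s t V → s ≢ t → nonSingleton s V ≡ true → nonSingleton t V ≡ true → ⊥
    distinct s t V s≢t ns-s ns-t = s≢t (fits-unique s t V (proj₁ (∧-≡-true⁻ ns-s)) (proj₁ (∧-≡-true⁻ ns-t)))
    both-disjoint : ∀ V → nonSingleton both V ∧ oneHub V ≡ false
    both-disjoint V = ∧-≡-false λ ns-both ns-one → case ∨-≡-true⁻ ns-one of λ where
      (inj₁ ns-l) → distinct both onlyˡ V (λ ()) ns-both ns-l
      (inj₂ ns-r) → distinct both onlyʳ V (λ ()) ns-both ns-r
    oneHub-disjoint : ∀ V → nonSingleton onlyˡ V ∧ nonSingleton onlyʳ V ≡ false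
    oneHub-disjoint V = ∧-≡-false (distinct onlyˡ onlyʳ V λ ())

  #nonSingleton-both : #nonSingleton both ≡ 2 ^ (a + b)
  #nonSingleton-both = begin
    #nonSingleton both
      ≡⟨ cong (_+ #nonSingleton both) (sym (countSubsets-none (λ V → fits both V ∧ isSingleton V) no-singleton)) ⟩
    countSubsets (λ V → fits both V ∧ isSingleton V) + #nonSingleton both
      ≡⟨ sym (countSubsets-split (fits both) isSingleton) ⟩
    countSubsets (fits both)
      ≡⟨ countSubsets-fits both ⟩
    2 ^ # isLeaf
      ≡⟨ cong (2 ^_) #isLeaf ⟩
    2 ^ (a + b) ∎
    where
    open ≡-Reasoning
    no-singleton : ∀ V → fits both V ∧ isSingleton V ≡ false
    no-singleton V with fits both V in fit
    ... | true = isSingleton-two V (fits-u both V fit) (fits-v both V fit) u≢v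
    ... | false = refl

  -- Among the subsets fitting a one-hub shape, the only singleton is that hub.
  suc-#nonSingleton : ∀ s h → free s (role h) ≡ false → (∀ i → required s (role i) ≡ does (i ≟ h)) →
                      suc (#nonSingleton s) ≡ 2 ^ # (free s)
  suc-#nonSingleton s h h-fixed required≡h = begin
    1 + #nonSingleton s
      ≡⟨ cong (_+ #nonSingleton s) (sym singleton-h) ⟩
    countSubsets (λ V → fits s V ∧ isSingleton V) + #nonSingleton s
      ≡⟨ sym (countSubsets-split (fits s) isSingleton) ⟩
    countSubsets (fits s)
      ≡⟨ countSubsets-fits s ⟩
    2 ^ # (free s) ∎
    where
    open ≡-Reasoning
    fits-⁅h⁆ : fits s ⁅ h ⁆ ≡ true
    fits-⁅h⁆ = fits⁺ s ⁅ h ⁆ λ i _ → trans (lookup-⁅⁆ h i) (sym (required≡h i))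
    only-⁅h⁆ : ∀ V → fits s V ∧ isSingleton V ≡ true → V ≡ ⁅ h ⁆
    only-⁅h⁆ V fit-single with ∧-≡-true⁻ fit-single
    ... | fit , single with isSingleton⇒ V single
    ...   | w , Vw , only = ≡⁅⁆ V h Vh (λ i Vi → trans (only i Vi) (sym (only h Vh)))
      where
      Vh : lookup V h ≡ true
      Vh = trans (fits⁻ s V h fit h-fixed) (trans (required≡h h) (dec-true (h ≟ h) refl))
    singleton-h : countSubsets (λ V → fits s V ∧ isSingleton V) ≡ 1
    singleton-h = countSubsets-point (λ V → fits s V ∧ isSingleton V) ⁅ h ⁆
                    (∧-≡-true⁺ fits-⁅h⁆ (isSingleton-⁅⁆ h)) only-⁅h⁆

  countSubsets-connectedSet : countSubsets connectedSet + 2 ≡ n + 2 ^ (a + b) + 2 ^ a + 2 ^ b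
  countSubsets-connectedSet = begin
    countSubsets connectedSet + 2
      ≡⟨ cong (_+ 2) countSubsets-connectedSet-split ⟩
    n + (#nonSingleton both + (#nonSingleton onlyˡ + #nonSingleton onlyʳ)) + 2
      ≡⟨ rearrange n (#nonSingleton both) (#nonSingleton onlyˡ) (#nonSingleton onlyʳ) ⟩
    n + #nonSingleton both + suc (#nonSingleton onlyˡ) + suc (#nonSingleton onlyʳ)
      ≡⟨ cong (λ x → n + x + suc (#nonSingleton onlyˡ) + suc (#nonSingleton onlyʳ)) #nonSingleton-both ⟩
    n + 2 ^ (a + b) + suc (#nonSingleton onlyˡ) + suc (#nonSingleton onlyʳ)
      ≡⟨ cong (λ x → n + 2 ^ (a + b) + x + suc (#nonSingleton onlyʳ))
              (suc-#nonSingleton onlyˡ u (cong (free onlyˡ) role-u) hubˡ==role) ⟩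
    n + 2 ^ (a + b) + 2 ^ a + suc (#nonSingleton onlyʳ)
      ≡⟨ cong (n + 2 ^ (a + b) + 2 ^ a +_) (suc-#nonSingleton onlyʳ v (cong (free onlyʳ) role-v) hubʳ==role) ⟩
    n + 2 ^ (a + b) + 2 ^ a + 2 ^ b ∎
    where
    open ≡-Reasoning
    rearrange : ∀ n x y z → n + (x + (y + z)) + 2 ≡ n + x + suc y + suc z
    rearrange = solve-∀

  edge-in : ∀ V {i j r s} → lookup V i ≡ true → lookup V j ≡ true → role i ≡ r → role j ≡ s →
            linked r s ≡ true → adj (induced G V) i j ≡ true
  edge-in V Vi Vj ri rj rs = induced-edge G V (edge ri rj rs) Vi Vj

  fits-absent : ∀ s V {a r} → fits s V ≡ true → role a ≡ r → free s r ≡ false → required s r ≡ false →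
                lookup V a ≡ false
  fits-absent s V {a} fit ra fixed absent =
    trans (fits⁻ s V a fit (trans (cong (free s) ra) fixed)) (trans (cong (required s) ra) absent)

  centre : Shape → Fin n
  centre both = u
  centre onlyˡ = u
  centre onlyʳ = v

  centre∈ : ∀ s V → fits s V ≡ true → lookup V (centre s) ≡ true
  centre∈ both V fit = fits-u both V fit
  centre∈ onlyˡ V fit = fits-u onlyˡ V fit
  centre∈ onlyʳ V fit = fits-v onlyʳ V fit

  to-centre : ∀ s V → fits s V ≡ true → ∀ a → lookup V a ≡ true → Walk (induced G V) a (centre s)
  to-centre s V fit a Va with s | role a in ra
  ... | both | hubˡ rewrite hubˡ-only ra = here
  ... | both | hubʳ rewrite hubʳ-only ra = step (edge-in V Vv Vu role-v role-u refl) here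
    where Vu = fits-u both V fit ; Vv = fits-v both V fit
  ... | both | leafˡ = step (edge-in V Va (fits-u both V fit) ra role-u refl) here
  ... | both | leafʳ = step (edge-in V Va Vv ra role-v refl) (step (edge-in V Vv Vu role-v role-u refl) here)
    where Vu = fits-u both V fit ; Vv = fits-v both V fit
  ... | onlyˡ | hubˡ rewrite hubˡ-only ra = here
  ... | onlyˡ | hubʳ = ⊥-elim (true≢false (trans (sym Va) (fits-absent onlyˡ V fit ra refl refl)))
  ... | onlyˡ | leafˡ = step (edge-in V Va (fits-u onlyˡ V fit) ra role-u refl) here
  ... | onlyˡ | leafʳ = ⊥-elim (true≢false (trans (sym Va) (fits-absent onlyˡ V fit ra refl refl)))
  ... | onlyʳ | hubˡ = ⊥-elim (true≢false (trans (sym Va) (fits-absent onlyʳ V fit ra refl refl)))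
  ... | onlyʳ | hubʳ rewrite hubʳ-only ra = here
  ... | onlyʳ | leafˡ = ⊥-elim (true≢false (trans (sym Va) (fits-absent onlyʳ V fit ra refl refl)))
  ... | onlyʳ | leafʳ = step (edge-in V Va (fits-v onlyʳ V fit) ra role-v refl) here

  connectedSet⇒connectedSubgraph : ∀ V → connectedSet V ≡ true → IsConnectedSubgraph G (V , induced G V)
  connectedSet⇒connectedSubgraph V set with ∨-≡-true⁻ set
  ... | inj₁ single with isSingleton⇒ V single
  ...   | w , Vw , only =
    induced-connected G V (proj₁ isSimple) (w , Vw) w
      λ a Va → subst (λ x → Walk (induced G V) x w) (sym (only a Va)) here
  connectedSet⇒connectedSubgraph V set | inj₂ some with shape some
    where
    shape : fitsSome V ≡ true → ∃ λ s → fits s V ≡ true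
    shape some with ∨-≡-true⁻ some
    ... | inj₁ fit = both , fit
    ... | inj₂ side with ∨-≡-true⁻ side
    ...   | inj₁ fit = onlyˡ , fit
    ...   | inj₂ fit = onlyʳ , fit
  ... | s , fit =
    induced-connected G V (proj₁ isSimple) (centre s , centre∈ s V fit) (centre s) (to-centre s V fit)

  leaf-neighbour-unique : ∀ {i j k} → isLeaf (role i) ≡ true → adj G i j ≡ true → adj G i k ≡ true → j ≡ k
  leaf-neighbour-unique {i} leaf ej ek with role i in ri
  ... | leafˡ = trans (neighbour-leafˡ ri ej) (sym (neighbour-leafˡ ri ek))
  ... | leafʳ = trans (neighbour-leafʳ ri ej) (sym (neighbour-leafʳ ri ek))

  edge-touches-hub : ∀ (P : Fin n → Set) {i j} → adj G i j ≡ true → P i → P j → P u ⊎ P v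
  edge-touches-hub P {i} e Pi Pj with role i in ri
  ... | hubˡ = inj₁ (subst P (hubˡ-only ri) Pi)
  ... | hubʳ = inj₂ (subst P (hubʳ-only ri) Pi)
  ... | leafˡ = inj₁ (subst P (neighbour-leafˡ ri e) Pj)
  ... | leafʳ = inj₂ (subst P (neighbour-leafʳ ri e) Pj)

  module Subgraph (V : Subset n) (B : Graph n)
    (B-sym : ∀ i j → adj B i j ≡ adj B j i)
    (B⊆G : ∀ i j → adj B i j ≡ true → adj G i j ≡ true)
    (B⊆V : ∀ i j → adj B i j ≡ true → lookup V i ≡ true × lookup V j ≡ true)
    (B-walk : ∀ i j → lookup V i ≡ true → lookup V j ≡ true → Walk B i j) where

    first-step : ∀ {i j} → lookup V i ≡ true → lookup V j ≡ true → i ≢ j → ∃ λ c → adj B i c ≡ true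
    first-step {i} {j} Vi Vj = first-edge (B-walk i j Vi Vj)

    leaf-edge : ∀ {i j} → isLeaf (role i) ≡ true → adj G i j ≡ true →
                lookup V i ≡ true → lookup V j ≡ true → adj B i j ≡ true
    leaf-edge {i} leaf e Vi Vj with first-step Vi Vj (edge-irrefl G isSimple e)
    ... | c , e′ = subst (λ x → adj B i x ≡ true) (leaf-neighbour-unique leaf (B⊆G i c e′) e) e′

    -- The edge uv is the only edge of G between the two sides, so every walk from u to v uses it.
    spine-edge : ∀ {i j} → role i ≡ hubˡ → role j ≡ hubʳ →
                 lookup V i ≡ true → lookup V j ≡ true → adj B i j ≡ true
    spine-edge {i} {j} ri rj Vi Vj
      with walk-exit (sideˡ ∘ role) (B-walk i j Vi Vj) (cong sideˡ ri) (cong sideˡ rj)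
    ... | x , y , e , Sx , Sy with linked-exitˡ (role x) (role y) (edge⁻ (B⊆G x y e)) Sx Sy
    ...   | rx , ry = subst₂ (λ p q → adj B p q ≡ true)
                        (trans (hubˡ-only rx) (sym (hubˡ-only ri))) (trans (hubʳ-only ry) (sym (hubʳ-only rj))) e

    induced⊆B : ∀ i j → adj G i j ≡ true → lookup V i ≡ true → lookup V j ≡ true → adj B i j ≡ true
    induced⊆B i j e Vi Vj with link (role i) (role j) (edge⁻ e)
    ... | hubs ri rj = spine-edge ri rj Vi Vj
    ... | hubs′ ri rj = trans (B-sym i j) (spine-edge rj ri Vj Vi)
    ... | from-leaf leaf = leaf-edge leaf e Vi Vj
    ... | to-leaf leaf = trans (B-sym i j) (leaf-edge leaf (trans (proj₁ isSimple j i) e) Vj Vi)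

    B≡induced : B ≡ induced G V
    B≡induced = ≡induced G V B B⊆G B⊆V induced⊆B

    far-leafʳ-absent : ∀ {i} → lookup V u ≡ true → lookup V v ≡ false → role i ≡ leafʳ → lookup V i ≡ false
    far-leafʳ-absent {i} Vu Vv ri = ¬-not λ Vi →
      let c , e = first-step Vi Vu λ { refl → case trans (sym ri) role-u of λ () }
      in true≢false (trans (sym (proj₂ (B⊆V i c e)))
                           (trans (cong (lookup V) (neighbour-leafʳ ri (B⊆G i c e))) Vv))

    far-leafˡ-absent : ∀ {i} → lookup V u ≡ false → lookup V v ≡ true → role i ≡ leafˡ → lookup V i ≡ false
    far-leafˡ-absent {i} Vu Vv ri = ¬-not λ Vi →
      let c , e = first-step Vi Vv λ { refl → case trans (sym ri) role-v of λ () }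
      in true≢false (trans (sym (proj₂ (B⊆V i c e)))
                           (trans (cong (lookup V) (neighbour-leafˡ ri (B⊆G i c e))) Vu))

    hubless-isolated : lookup V u ≡ false → lookup V v ≡ false →
                       ∀ {w} → lookup V w ≡ true → ∀ i → lookup V i ≡ true → i ≡ w
    hubless-isolated Vu Vv {w} Vw i Vi with i ≟ w
    ... | yes i≡w = i≡w
    ... | no i≢w with first-step Vw Vi (i≢w ∘ sym)
    ...   | c , e with edge-touches-hub (λ x → lookup V x ≡ true) (B⊆G w c e) Vw (proj₂ (B⊆V w c e))
    ...     | inj₁ Vu′ = ⊥-elim (true≢false (trans (sym Vu′) Vu))
    ...     | inj₂ Vv′ = ⊥-elim (true≢false (trans (sym Vv′) Vv))

    connectedSubgraph⇒connectedSet : (∃ λ w → lookup V w ≡ true) → connectedSet V ≡ true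
    connectedSubgraph⇒connectedSet (w , Vw) with lookup V u in Vu | lookup V v in Vv
    ... | true | true = ∨-≡-true⁺ʳ (isSingleton V) (∨-≡-true⁺ˡ _ (fits⁺ both V fixed))
      where
      fixed : ∀ i → free both (role i) ≡ false → lookup V i ≡ required both (role i)
      fixed i _ with role i in ri
      ... | hubˡ rewrite hubˡ-only ri = Vu
      ... | hubʳ rewrite hubʳ-only ri = Vv
    ... | true | false =
      ∨-≡-true⁺ʳ (isSingleton V) (∨-≡-true⁺ʳ (fits both V) (∨-≡-true⁺ˡ _ (fits⁺ onlyˡ V fixed)))
      where
      fixed : ∀ i → free onlyˡ (role i) ≡ false → lookup V i ≡ required onlyˡ (role i)
      fixed i _ with role i in ri
      ... | hubˡ rewrite hubˡ-only ri = Vu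
      ... | hubʳ rewrite hubʳ-only ri = Vv
      ... | leafʳ = far-leafʳ-absent Vu Vv ri
    ... | false | true =
      ∨-≡-true⁺ʳ (isSingleton V) (∨-≡-true⁺ʳ (fits both V) (∨-≡-true⁺ʳ (fits onlyˡ V) (fits⁺ onlyʳ V fixed)))
      where
      fixed : ∀ i → free onlyʳ (role i) ≡ false → lookup V i ≡ required onlyʳ (role i)
      fixed i _ with role i in ri
      ... | hubˡ rewrite hubˡ-only ri = Vu
      ... | hubʳ rewrite hubʳ-only ri = Vv
      ... | leafˡ = far-leafˡ-absent Vu Vv ri
    ... | false | false = ∨-≡-true⁺ˡ (fitsSome V) (isSingleton⇐ V w Vw (hubless-isolated Vu Vv Vw))

  coreIndex : CoreIndex G (countSubsets connectedSet)
  coreIndex = HasSize-image (λ V → V , induced G V) (cong proj₁) image (HasSize-countSubsets connectedSet)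
    where
    image : ∀ x → IsConnectedSubgraph G x ⇔ (∃ λ V → connectedSet V ≡ true × (V , induced G V) ≡ x)
    image (V , B) = mk⇔ to from
      where
      to : IsConnectedSubgraph G (V , B) →
           ∃ λ V′ → connectedSet V′ ≡ true × (V′ , induced G V′) ≡ (V , B)
      to (nonempty , B-sym , B⊆G , B⊆V , B-walk) =
        V , connectedSubgraph⇒connectedSet nonempty , cong (V ,_) (sym B≡induced)
        where open Subgraph V B B-sym B⊆G B⊆V B-walk
      from : (∃ λ V′ → connectedSet V′ ≡ true × (V′ , induced G V′) ≡ (V , B)) →
             IsConnectedSubgraph G (V , B)
      from (V , set , refl) = connectedSet⇒connectedSubgraph V set

-- Graphs with two branch vertices

module BranchPair {n} {G : Graph n} (simple : IsSimple G) (connected : Connected G)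
  {u v : Fin n} (u≢v : u ≢ v) (pendant : ∀ i → i ≢ u → i ≢ v → degree G i ≡ 1) where

  sym-G : ∀ i j → adj G i j ≡ adj G j i
  sym-G = proj₁ simple

  pendant-neighbour : ∀ {i j} → i ≢ u → i ≢ v → adj G i j ≡ true → j ≡ u ⊎ j ≡ v
  pendant-neighbour {i} {j} i≢u i≢v e with j ≟ u | j ≟ v
  ... | yes j≡u | _ = inj₁ j≡u
  ... | no _ | yes j≡v = inj₂ j≡v
  ... | no j≢u | no j≢v
    with pendant-pair-closed G (pendant i i≢u i≢v) (pendant j j≢u j≢v) e (trans (sym-G j i) e)
                             (inj₁ refl) (connected i u)
  ...   | inj₁ u≡i = ⊥-elim (i≢u (sym u≡i))
  ...   | inj₂ u≡j = ⊥-elim (j≢u (sym u≡j))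

  -- Before reaching v a walk from u can only visit u and its pendant neighbours.
  reach-v : ∀ {a} → a ≡ u ⊎ adj G a u ≡ true → Walk G a v → adj G u v ≡ true
  reach-v (inj₁ v≡u) here = ⊥-elim (u≢v (sym v≡u))
  reach-v (inj₂ vu) here = trans (sym-G u v) vu
  reach-v (inj₁ refl) (step {w = w} e walk) = reach-v (inj₂ (trans (sym-G w u) e)) walk
  reach-v {a} (inj₂ au) (step e walk) with a ≟ v
  ... | yes refl = trans (sym-G u v) au
  ... | no a≢v = reach-v (inj₁ (degree≡1-unique G (pendant a (edge-irrefl G simple au) a≢v) e au)) walk

  spine : adj G u v ≡ true
  spine = reach-v (inj₁ refl) (connected u v)

  data Kind (i : Fin n) : Set where
    is-u : i ≡ u → Kind i
    is-v : i ≡ v → Kind i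
    is-pendant : i ≢ u → i ≢ v → Kind i

  kind : ∀ i → Kind i
  kind i with i ≟ u | i ≟ v
  ... | yes i≡u | _ = is-u i≡u
  ... | no _ | yes i≡v = is-v i≡v
  ... | no i≢u | no i≢v = is-pendant i≢u i≢v

  leafOn : Bool → Role
  leafOn true = leafˡ
  leafOn false = leafʳ

  role : Fin n → Role
  role i with kind i
  ... | is-u _ = hubˡ
  ... | is-v _ = hubʳ
  ... | is-pendant _ _ = leafOn (adj G i u)

  role-u : role u ≡ hubˡ
  role-u with kind u
  ... | is-u _ = refl
  ... | is-v u≡v = ⊥-elim (u≢v u≡v)
  ... | is-pendant u≢u _ = ⊥-elim (u≢u refl)

  role-v : role v ≡ hubʳ
  role-v with kind v
  ... | is-u v≡u = ⊥-elim (u≢v (sym v≡u))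
  ... | is-v _ = refl
  ... | is-pendant _ v≢v = ⊥-elim (v≢v refl)

  hubˡ-only : ∀ {i} → role i ≡ hubˡ → i ≡ u
  hubˡ-only {i} ri with kind i | ri
  ... | is-u i≡u | _ = i≡u
  ... | is-pendant _ _ | leaf≡hub with adj G i u
  ...   | true = case leaf≡hub of λ ()
  ...   | false = case leaf≡hub of λ ()

  hubʳ-only : ∀ {i} → role i ≡ hubʳ → i ≡ v
  hubʳ-only {i} ri with kind i | ri
  ... | is-v i≡v | _ = i≡v
  ... | is-pendant _ _ | leaf≡hub with adj G i u
  ...   | true = case leaf≡hub of λ ()
  ...   | false = case leaf≡hub of λ ()

  role-pendant : ∀ {i} → i ≢ u → i ≢ v → role i ≡ leafOn (adj G i u)
  role-pendant {i} i≢u i≢v with kind i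
  ... | is-u i≡u = ⊥-elim (i≢u i≡u)
  ... | is-v i≡v = ⊥-elim (i≢v i≡v)
  ... | is-pendant _ _ = refl

  adj-pendant : ∀ {i} → i ≢ u → i ≢ v → ∀ j → adj G i j ≡ linked (role i) (role j)
  adj-pendant {i} i≢u i≢v j rewrite role-pendant i≢u i≢v with adj G i u in iu
  ... | true = trans adj≡ (trans (sym (==-role role role-u hubˡ-only j)) (sym (linked-leafˡ≡ (role j))))
    where
    adj≡ : adj G i j ≡ does (j ≟ u)
    adj≡ with j ≟ u
    ... | yes refl = iu
    ... | no j≢u = ¬-not λ ij → j≢u (degree≡1-unique G (pendant i i≢u i≢v) ij iu)
  ... | false = trans adj≡ (trans (sym (==-role role role-v hubʳ-only j)) (sym (linked-leafʳ≡ (role j))))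
    where
    adj≡ : adj G i j ≡ does (j ≟ v)
    adj≡ with j ≟ v
    ... | yes refl with degree≡1⇒ G i (pendant i i≢u i≢v)
    ...   | w , iw , _ with pendant-neighbour i≢u i≢v iw
    ...     | inj₁ refl = ⊥-elim (true≢false (trans (sym iw) iu))
    ...     | inj₂ refl = iw
    adj≡ | no j≢v = ¬-not λ ij → case pendant-neighbour i≢u i≢v ij of λ where
      (inj₁ refl) → true≢false (trans (sym ij) iu)
      (inj₂ j≡v) → j≢v j≡v

  adj-by-kind : ∀ {i j} → Kind i → Kind j → adj G i j ≡ linked (role i) (role j)
  adj-by-kind (is-pendant i≢u i≢v) _ = adj-pendant i≢u i≢v _
  adj-by-kind {i} {j} _ (is-pendant j≢u j≢v) =
    trans (sym-G i j) (trans (adj-pendant j≢u j≢v i) (linked-sym (role j) (role i)))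
  adj-by-kind (is-u refl) (is-u refl) rewrite role-u = proj₂ simple u
  adj-by-kind (is-u refl) (is-v refl) rewrite role-u | role-v = spine
  adj-by-kind (is-v refl) (is-u refl) rewrite role-u | role-v = trans (sym-G v u) spine
  adj-by-kind (is-v refl) (is-v refl) rewrite role-v = proj₂ simple v

  adj-role : ∀ i j → adj G i j ≡ linked (role i) (role j)
  adj-role i j = adj-by-kind (kind i) (kind j)

  doubleStar : DoubleStar G
  doubleStar = record
    { role = role ; adj-role = adj-role ; u = u ; v = v
    ; role-u = role-u ; role-v = role-v ; hubˡ-only = hubˡ-only ; hubʳ-only = hubʳ-only }

≡ᵇ1⇒ : ∀ {m} → (m ≡ᵇ 1) ≡ true → m ≡ 1
≡ᵇ1⇒ {suc zero} _ = refl

≢ᵇ1⇒ : ∀ {m} → not (m ≡ᵇ 1) ≡ true → m ≢ 1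
≢ᵇ1⇒ {suc zero} () refl

suc≢1⇒1≤ : ∀ {m} → suc m ≢ 1 → 1 ≤ m
suc≢1⇒1≤ {zero} 1≢1 = ⊥-elim (1≢1 refl)
suc≢1⇒1≤ {suc m} _ = s≤s z≤n

two-branch-vertices : ∀ {n} (G : Graph n) → 2 ≤ n → pendantCount G ≡ n ∸ 2 →
                      count (λ i → not (degree G i ≡ᵇ 1)) ≡ 2
two-branch-vertices {n} G 2≤n pendants = +-cancelˡ-≡ (n ∸ 2) _ 2 (begin
  n ∸ 2 + count branch   ≡⟨ cong (_+ count branch) (trans (sym pendants) (trues-tabulate pendant)) ⟩
  count pendant + count branch ≡⟨ sym (count-split (λ _ → true) pendant) ⟩
  count {n} (λ _ → true) ≡⟨ count-true n ⟩
  n                      ≡⟨ sym (m+[n∸m]≡n 2≤n) ⟩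
  2 + (n ∸ 2)            ≡⟨ +-comm 2 (n ∸ 2) ⟩
  n ∸ 2 + 2              ∎)
  where
  open ≡-Reasoning
  pendant branch : Fin n → Bool
  pendant i = degree G i ≡ᵇ 1
  branch i = not (pendant i)

doubleStar-of-pendants : ∀ {n} (G : Graph n) → 2 ≤ n → IsSimple G → Connected G → pendantCount G ≡ n ∸ 2 →
                         Σ (DoubleStar G) λ D → 1 ≤ DoubleStarProperties.a D × 1 ≤ DoubleStarProperties.b D
doubleStar-of-pendants G 2≤n simple connected pendants
  with count≡2⇒ (λ i → not (degree G i ≡ᵇ 1)) (two-branch-vertices G 2≤n pendants)
... | u , v , u≢v , branch-u , branch-v , only =
  D , suc≢1⇒1≤ (≢ᵇ1⇒ branch-u ∘ trans (degree-u D))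
    , suc≢1⇒1≤ (≢ᵇ1⇒ branch-v ∘ trans (degree-v D))
  where
  pendant : ∀ i → i ≢ u → i ≢ v → degree G i ≡ 1
  pendant i i≢u i≢v = ≡ᵇ1⇒ (not-injective (¬-not λ branch-i → case only i branch-i of λ where
    (inj₁ i≡u) → i≢u i≡u
    (inj₂ i≡v) → i≢v i≡v))
  D = BranchPair.doubleStar simple connected u≢v pendant
  open DoubleStarProperties using (degree-u; degree-v)

-- The extremal bound

x+y≤xy+1 : ∀ x y → 1 ≤ x → 1 ≤ y → x + y ≤ x * y + 1
x+y≤xy+1 (suc p) (suc q) _ _ = subst (suc p + suc q ≤_) (expand p q) (m≤m+n (suc p + suc q) (p * q))
  where
  expand : ∀ p q → suc p + suc q + p * q ≡ suc p * suc q + 1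
  expand = solve-∀

double-star-bound : ∀ n a b → 1 ≤ a → 1 ≤ b →
                    n + 2 ^ (a + b) + 2 ^ a + 2 ^ b ≤ 3 * 2 ^ (a + b ∸ 1) + n + 2
double-star-bound n (suc a) (suc b) _ _ = begin
  n + 2 ^ (suc a + suc b) + 2 ^ suc a + 2 ^ suc b
    ≡⟨ cong (λ z → n + 2 * z + 2 * x + 2 * y) (^-distribˡ-+-* 2 a (suc b)) ⟩
  n + 2 * (x * (2 * y)) + 2 * x + 2 * y
    ≡⟨ regroup n x y ⟩
  n + 4 * (x * y) + 2 * (x + y)
    ≤⟨ +-monoʳ-≤ (n + 4 * (x * y)) (*-monoʳ-≤ 2 (x+y≤xy+1 x y (m^n>0 2 a) (m^n>0 2 b))) ⟩
  n + 4 * (x * y) + 2 * (x * y + 1)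
    ≡⟨ regroup′ n x y ⟩
  3 * (x * (2 * y)) + n + 2
    ≡⟨ cong (λ z → 3 * z + n + 2) (sym (^-distribˡ-+-* 2 a (suc b))) ⟩
  3 * 2 ^ (a + suc b) + n + 2 ∎
  where
  open ≤-Reasoning
  x y : ℕ
  x = 2 ^ a
  y = 2 ^ b
  regroup : ∀ n x y → n + 2 * (x * (2 * y)) + 2 * x + 2 * y ≡ n + 4 * (x * y) + 2 * (x + y)
  regroup = solve-∀
  regroup′ : ∀ n x y → n + 4 * (x * y) + 2 * (x * y + 1) ≡ 3 * (x * (2 * y)) + n + 2
  regroup′ = solve-∀

double-star-exact : ∀ n b → n + 2 ^ (1 + b) + 2 ^ 1 + 2 ^ b ≡ 3 * 2 ^ b + n + 2
double-star-exact n b = regroup n (2 ^ b)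
  where
  regroup : ∀ n y → n + 2 * y + 2 + y ≡ 3 * y + n + 2
  regroup = solve-∀

core-index-bound : ∀ {n} (G : Graph n) → 2 ≤ n → IsSimple G → Connected G → pendantCount G ≡ n ∸ 2 →
                   ∀ k → CoreIndex G k → k ≤ 3 * 2 ^ (n ∸ 3) + n
core-index-bound {n} G 2≤n simple connected pendants k core-k =
  bound (doubleStar-of-pendants G 2≤n simple connected pendants)
  where
  bound : Σ (DoubleStar G) (λ D → 1 ≤ DoubleStarProperties.a D × 1 ≤ DoubleStarProperties.b D) →
          k ≤ 3 * 2 ^ (n ∸ 3) + n
  bound (D , 1≤a , 1≤b) = +-cancelʳ-≤ 2 k (3 * 2 ^ (n ∸ 3) + n) (begin
    k + 2                               ≡⟨ cong (_+ 2) (HasSize-unique core-k coreIndex) ⟩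
    countSubsets connectedSet + 2            ≡⟨ countSubsets-connectedSet ⟩
    n + 2 ^ (a + b) + 2 ^ a + 2 ^ b     ≤⟨ double-star-bound n a b 1≤a 1≤b ⟩
    3 * 2 ^ (a + b ∸ 1) + n + 2         ≡⟨ cong (λ e → 3 * 2 ^ e + n + 2) (sym n∸3) ⟩
    3 * 2 ^ (n ∸ 3) + n + 2             ∎)
    where
    open DoubleStarProperties D
    open ≤-Reasoning
    n∸3 : n ∸ 3 ≡ a + b ∸ 1
    n∸3 = trans (cong (_∸ 3) (sym vertex-count)) (cong (_∸ 2) (+-suc a b))

-- The tree T(1, k + 1, 2)

<ᵇ-true : ∀ {x m} → x < m → (x <ᵇ m) ≡ true
<ᵇ-true x<m = Equivalence.to T-≡ (<⇒<ᵇ x<m)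

roleT : ℕ → Role
roleT 0 = hubˡ
roleT 1 = hubʳ
roleT 2 = leafˡ
roleT (suc (suc (suc _))) = leafʳ

Tadj-role : ∀ m a b → a < 3 + m → b < 3 + m → Tadj 1 m 2 a b ≡ linked (roleT a) (roleT b)
Tadj-role m 0 0 _ _ = refl
Tadj-role m 0 1 _ _ = refl
Tadj-role m 0 2 _ _ = refl
Tadj-role m 0 (suc (suc (suc y))) _ _ = refl
Tadj-role m 1 0 _ _ = refl
Tadj-role m 1 1 _ _ = refl
Tadj-role m 1 2 _ _ = refl
Tadj-role m 1 (suc (suc (suc y))) _ (s≤s (s≤s (s≤s y<m))) rewrite <ᵇ-true y<m = refl
Tadj-role m 2 0 _ _ = refl
Tadj-role m 2 1 _ _ = refl
Tadj-role m 2 2 _ _ = refl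
Tadj-role m 2 (suc (suc (suc y))) _ _ rewrite ∧-zeroʳ (0 ≡ᵇ y) = refl
Tadj-role m (suc (suc (suc x))) 0 _ _ = refl
Tadj-role m (suc (suc (suc x))) 1 (s≤s (s≤s (s≤s x<m))) _ rewrite <ᵇ-true x<m = refl
Tadj-role m (suc (suc (suc x))) 2 _ _ rewrite ∧-zeroʳ (0 ≡ᵇ x) = refl
Tadj-role m (suc (suc (suc x))) (suc (suc (suc y))) _ _
  rewrite ∧-zeroʳ (suc x ≡ᵇ y) | ∧-zeroʳ (suc y ≡ᵇ x) = refl

roleT≡hubˡ : ∀ {a} → roleT a ≡ hubˡ → a ≡ 0
roleT≡hubˡ {0} _ = refl
roleT≡hubˡ {1} ()
roleT≡hubˡ {2} ()
roleT≡hubˡ {suc (suc (suc _))} ()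

roleT≡hubʳ : ∀ {a} → roleT a ≡ hubʳ → a ≡ 1
roleT≡hubʳ {0} ()
roleT≡hubʳ {1} _ = refl
roleT≡hubʳ {2} ()
roleT≡hubʳ {suc (suc (suc _))} ()

roleT≡leafˡ : ∀ {a} → roleT a ≡ leafˡ → a ≡ 2
roleT≡leafˡ {0} ()
roleT≡leafˡ {1} ()
roleT≡leafˡ {2} _ = refl
roleT≡leafˡ {suc (suc (suc _))} ()

module T-1-1+k-2 (k : ℕ) where

  N : ℕ
  N = 1 + suc k + 2

  N≡4+k : N ≡ 4 + k
  N≡4+k = cong (λ x → suc (suc x)) (+-comm k 2)

  doubleStar : DoubleStar (T 1 (suc k) 2)
  doubleStar = record
    { role = roleT ∘ toℕ
    ; adj-role = λ i j → trans (adj-tabulate (λ i j → Tadj 1 (suc k) 2 (toℕ i) (toℕ j)) i j)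
                               (Tadj-role (suc k) (toℕ i) (toℕ j) (bounded i) (bounded j))
    ; u = zero ; v = suc zero ; role-u = refl ; role-v = refl
    ; hubˡ-only = toℕ-injective ∘ roleT≡hubˡ
    ; hubʳ-only = toℕ-injective ∘ roleT≡hubʳ }
    where
    bounded : ∀ (i : Fin N) → toℕ i < 4 + k
    bounded i = subst (toℕ i <_) N≡4+k (toℕ<n i)

  open DoubleStarProperties doubleStar

  a≡1 : a ≡ 1
  a≡1 = count-point (λ i → leafˡ == roleT (toℕ i)) w (cong (λ x → leafˡ == roleT x) (toℕ-fromℕ< 2<N))
                    only-w
    where
    2<N : 2 < N
    2<N = subst (2 <_) (sym N≡4+k) (s≤s (s≤s (s≤s z≤n)))
    w : Fin N
    w = fromℕ< 2<N
    only-w : ∀ i → leafˡ == roleT (toℕ i) ≡ true → i ≡ w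
    only-w i leaf = toℕ-injective (trans (roleT≡leafˡ (sym (==-sound leaf))) (sym (toℕ-fromℕ< 2<N)))

  b≡1+k : b ≡ suc k
  b≡1+k = suc-injective (suc-injective (suc-injective (begin
    3 + b          ≡⟨ cong (λ x → suc x + suc b) (sym a≡1) ⟩
    suc a + suc b  ≡⟨ vertex-count ⟩
    N              ≡⟨ N≡4+k ⟩
    4 + k          ∎)))
    where open ≡-Reasoning

  pendants : pendantCount (T 1 (suc k) 2) ≡ 2 + k
  pendants = trans (pendantCount≡ (≤-reflexive (sym a≡1)) (subst (1 ≤_) (sym b≡1+k) (s≤s z≤n)))
                   (cong₂ _+_ a≡1 b≡1+k)

  core-index : CoreIndex (T 1 (suc k) 2) (3 * 2 ^ suc k + (4 + k))
  core-index = subst (CoreIndex (T 1 (suc k) 2)) (+-cancelʳ-≡ 2 _ _ (begin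
    countSubsets connectedSet + 2                     ≡⟨ countSubsets-connectedSet ⟩
    N + 2 ^ (a + b) + 2 ^ a + 2 ^ b              ≡⟨ cong₂ (λ x y → N + 2 ^ (x + y) + 2 ^ x + 2 ^ y) a≡1 b≡1+k ⟩
    N + 2 ^ (1 + suc k) + 2 ^ 1 + 2 ^ suc k      ≡⟨ double-star-exact N (suc k) ⟩
    3 * 2 ^ suc k + N + 2                        ≡⟨ cong (λ x → 3 * 2 ^ suc k + x + 2) N≡4+k ⟩
    3 * 2 ^ suc k + (4 + k) + 2                  ∎)) coreIndex
    where open ≡-Reasoning

theorem5p2 : ∀ (n : ℕ) → 4 ≤ n →
    ((IsSimple (T 1 (n ∸ 3) 2) × Connected (T 1 (n ∸ 3) 2) × pendantCount (T 1 (n ∸ 3) 2) ≡ n ∸ 2)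
    × CoreIndex (T 1 (n ∸ 3) 2) (3 * 2 ^ (n ∸ 3) + n)
    × (∀ (G : Graph n) → IsSimple G → Connected G → pendantCount G ≡ n ∸ 2 →
    ∀ (k : ℕ) → CoreIndex G k → k ≤ 3 * 2 ^ (n ∸ 3) + n))
theorem5p2 (suc (suc (suc (suc k)))) (s≤s (s≤s (s≤s (s≤s _)))) =
  (isSimple , connected , pendants) , core-index , λ G → core-index-bound G (s≤s (s≤s z≤n))
  where
  open T-1-1+k-2 k
  open DoubleStarProperties doubleStar using (isSimple; connected)
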